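{- Let $\mathcal{A} \subset \omega^\omega$ be a MAD family with trivial trace, and suppose $X \in [\omega \times \omega]^\omega$ avoids $\mathcal{A}$. Then there is $Y \in [X]^\omega$ such that $|h \cap Y| < \omega$ for all $h \in \mathcal{A}$.
   Context: Functions are identified with their graphs (subsets of $\omega\times\omega$). An a.d. family $\mathcal{A}\subset\omega^\omega$ is one with $|f\cap g|<\omega$ for distinct $f,g\in\mathcal{A}$; it is a MAD family in $\omega^\omega$ if moreover every $f\in\omega^\omega$ satisfies $|f\cap h|=\omega$ for some $h\in\mathcal{A}$. For $f\in\omega^\omega$, a MAD family on $f$ is an a.d. family of infinite subsets of $f$ such that every infinite subset of $f$ meets some member in an infinite set (the family may be finite). $\mathcal{A}\cap f=\{f\cap h: h\in\mathcal{A},\ |f\cap h|=\omega\}$ and $\mathrm{tr}(\mathcal{A})=\{f\in\omega^\omega:\mathcal{A}\cap f\text{ is a MAD family on } f\}$. A set $X\in[\omega\times\omega]^\omega$ avoids $\mathcal{A}$ if for every finite $\{h_0,\dots,h_n\}\subset\mathcal{A}$, $|X\setminus(h_0\cup\dots\cup h_n)|=\omega$. $\mathcal{A}$ has trivial trace if no member of $\mathrm{tr}(\mathcal{A})$ avoids $\mathcal{A}$. -}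

module Defs where

open import Level using (0ℓ; suc)
open import Data.Nat using (ℕ; _<_)
open import Data.Product using (Σ; ∃; _×_)
open import Data.List using (List)
open import Data.List.Relation.Unary.All using (All)
open import Data.List.Relation.Unary.Any using (Any)
open import Relation.Nullary using (¬_)
open import Relation.Binary.PropositionalEquality using (_≡_)
open import Axiom.ExcludedMiddle using (ExcludedMiddle)

Rel2 : Set₁
Rel2 = ℕ → ℕ → Set

-- Functions ω → ω are identified with their graphs.
graph : (ℕ → ℕ) → Rel2
graph f n m = f n ≡ m

_∩_ : Rel2 → Rel2 → Rel2
(X ∩ Y) n m = X n m × Y n m

_⊆_ : Rel2 → Rel2 → Set
X ⊆ Y = ∀ n m → X n m → Y n m

_≐_ : Rel2 → Rel2 → Set
X ≐ Y = X ⊆ Y × Y ⊆ X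

Finite : Rel2 → Set
Finite X = ∃ λ N → ∀ n m → X n m → n < N × m < N

Infinite : Rel2 → Set
Infinite X = ¬ Finite X

Family : Set₁
Family = (ℕ → ℕ) → Set

Distinct : (ℕ → ℕ) → (ℕ → ℕ) → Set
Distinct f g = ¬ (∀ n → f n ≡ g n)

AlmostDisjoint : Family → Set
AlmostDisjoint 𝒜 = ∀ f g → 𝒜 f → 𝒜 g → Distinct f g → Finite (graph f ∩ graph g)

MAD : Family → Set
MAD 𝒜 = AlmostDisjoint 𝒜 × (∀ f → ∃ λ h → 𝒜 h × Infinite (graph f ∩ graph h))

MADOn : Rel2 → (Rel2 → Set) → Set₁
MADOn F ℬ =
  (∀ Y → ℬ Y → Y ⊆ F × Infinite Y) ×
  (∀ Y Z → ℬ Y → ℬ Z → ¬ (Y ≐ Z) → Finite (Y ∩ Z)) ×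
  (∀ Z → Z ⊆ F → Infinite Z → Σ Rel2 λ Y → ℬ Y × Infinite (Z ∩ Y))

TraceFamily : Family → (ℕ → ℕ) → Rel2 → Set
TraceFamily 𝒜 f Y = ∃ λ h → 𝒜 h × Infinite (graph f ∩ graph h) × Y ≐ (graph f ∩ graph h)

InTrace : Family → (ℕ → ℕ) → Set₁
InTrace 𝒜 f = MADOn (graph f) (TraceFamily 𝒜 f)

UnionGraphs : List (ℕ → ℕ) → Rel2
UnionGraphs hs n m = Any (λ h → h n ≡ m) hs

_∖_ : Rel2 → Rel2 → Rel2
(X ∖ Y) n m = X n m × ¬ Y n m

Avoids : Rel2 → Family → Set
Avoids X 𝒜 = ∀ (hs : List (ℕ → ℕ)) → All 𝒜 hs → Infinite (X ∖ UnionGraphs hs)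

TrivialTrace : Family → Set₁
TrivialTrace 𝒜 = ∀ f → InTrace 𝒜 f → ¬ Avoids (graph f) 𝒜

-- classical logic (the paper works in ZFC)
LEM : Set₂
LEM = ExcludedMiddle (suc 0ℓ)

-- Suppose no such Y exists, so every infinite subset of X meets some member of 𝒜 infinitely.
-- Since X avoids 𝒜, this yields h₀, h₁, … ∈ 𝒜 with hₙ meeting X ∖ (h₀ ∪ … ∪ hₙ₋₁) infinitely,
-- so the hₙ are distinct. Choose points t₀ < t₁ < … with (tₛ, hₙ(tₛ)) ∈ X for n = σ(s), where
-- the schedule σ takes every value infinitely often, and let f follow h_σ(s) at tₛ and h₀
-- elsewhere. An infinite part of f lies infinitely often either in X, where it meets 𝒜 by
-- assumption, or on h₀; with almost disjointness this puts f in tr(𝒜). Finitely many members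
-- of 𝒜 all differ from some hₙ, so they cover only a finite part of it, while f agrees with hₙ
-- at arbitrarily large tₛ: f avoids 𝒜, contradicting the triviality of the trace.
module Submission where

open import Defs
open import Data.Product using (Σ; _×_; _,_; proj₁; proj₂; ∃; map; map₂)
open import Data.Sum using (_⊎_; inj₁; inj₂)
open import Data.Empty using (⊥-elim)
open import Data.Nat using (ℕ; zero; suc; _+_; _≤_; _<_; z≤n; s≤s)
open import Data.Nat.Properties
open import Data.List using (List; []; _∷_)
open import Data.List.Relation.Unary.All using (All; []; _∷_)
open import Data.List.Relation.Unary.Any using (here; there)
open import Function using (_∘_)
open import Level using (lift; lower)
open import Relation.Nullary using (¬_; Dec; yes; no)
open import Relation.Nullary.Decidable using (map′; decidable-stable)
open import Relation.Binary.Definitions using (tri<; tri≈; tri>)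
open import Relation.Binary.PropositionalEquality using (_≡_; refl; sym; trans; cong; subst)

_↾_ : Rel2 → (ℕ → Set) → Rel2
(Z ↾ P) n m = Z n m × P n

Meets : Family → Rel2 → Set
Meets 𝒜 Z = ∃ λ g → 𝒜 g × Infinite (graph g ∩ Z)

EveryInfinitePartMeets : Family → Rel2 → Set₁
EveryInfinitePartMeets 𝒜 X = ∀ Z → Z ⊆ X → Infinite Z → Meets 𝒜 Z

Finite-⊆ : {Z W : Rel2} → Z ⊆ W → Finite W → Finite Z
Finite-⊆ Z⊆W (N , bounded) = N , λ n m z → bounded n m (Z⊆W n m z)

Infinite-⊇ : {Z W : Rel2} → Z ⊆ W → Infinite Z → Infinite W
Infinite-⊇ Z⊆W infinite = infinite ∘ Finite-⊆ Z⊆W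

Finite-∪ : {Z Z₁ Z₂ : Rel2} → (∀ n m → Z n m → Z₁ n m ⊎ Z₂ n m) →
           Finite Z₁ → Finite Z₂ → Finite Z
Finite-∪ {Z₁ = Z₁} {Z₂} cover (N₁ , bounded₁) (N₂ , bounded₂) = N₁ + N₂ , λ n m z → bound (cover n m z)
  where
  bound : ∀ {n m} → Z₁ n m ⊎ Z₂ n m → n < N₁ + N₂ × m < N₁ + N₂
  bound (inj₁ p) = map (m≤n⇒m≤n+o N₂) (m≤n⇒m≤n+o N₂) (bounded₁ _ _ p)
  bound (inj₂ p) = map (m≤n⇒m≤o+n N₁) (m≤n⇒m≤o+n N₁) (bounded₂ _ _ p)

point-Finite : (a b : ℕ) → Finite (λ n m → n ≡ a × m ≡ b)
point-Finite a b = suc (a + b) , λ { _ _ (refl , refl) → s≤s (m≤m+n a b) , s≤s (m≤n+m b a) }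

graph-below-Finite : (h : ℕ → ℕ) (M : ℕ) → Finite (graph h ↾ (_< M))
graph-below-Finite h zero = zero , λ _ _ ()
graph-below-Finite h (suc M) = Finite-∪ split (graph-below-Finite h M) (point-Finite M (h M))
  where
  split : ∀ n m → (graph h ↾ (_< suc M)) n m → (graph h ↾ (_< M)) n m ⊎ (n ≡ M × m ≡ h M)
  split n m (hn≡m , n<1+M) with m<1+n⇒m<n∨m≡n n<1+M
  ... | inj₁ n<M = inj₁ (hn≡m , n<M)
  ... | inj₂ refl = inj₂ (refl , sym hn≡m)

graph-∩-unbounded : {Z : Rel2} (h : ℕ → ℕ) → Infinite (graph h ∩ Z) →
                    (M : ℕ) → ¬ (∀ m → M ≤ m → ¬ Z m (h m))
graph-∩-unbounded {Z} h infinite M none = infinite (Finite-⊆ below (graph-below-Finite h M))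
  where
  below : (graph h ∩ Z) ⊆ (graph h ↾ (_< M))
  below n m (refl , z) = refl , ≰⇒> (λ M≤n → none n M≤n z)

UnionGraphs-meets-Finite : {𝒜 : Family} → AlmostDisjoint 𝒜 → {g : ℕ → ℕ} → 𝒜 g →
                           {gs : List (ℕ → ℕ)} → All 𝒜 gs → All (λ g′ → Distinct g′ g) gs →
                           Finite (graph g ∩ UnionGraphs gs)
UnionGraphs-meets-Finite ad g∈𝒜 [] [] = zero , λ { _ _ (_ , ()) }
UnionGraphs-meets-Finite ad {g} g∈𝒜 {g′ ∷ gs} (g′∈𝒜 ∷ gs∈𝒜) (g′≠g ∷ gs≠g) =
  Finite-∪ split (ad g′ g g′∈𝒜 g∈𝒜 g′≠g) (UnionGraphs-meets-Finite ad g∈𝒜 gs∈𝒜 gs≠g)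
  where
  split : ∀ n m → (graph g ∩ UnionGraphs (g′ ∷ gs)) n m →
          (graph g′ ∩ graph g) n m ⊎ (graph g ∩ UnionGraphs gs) n m
  split n m (gn≡m , here g′n≡m) = inj₁ (g′n≡m , gn≡m)
  split n m (gn≡m , there u) = inj₂ (gn≡m , u)

module _ {t : ℕ → ℕ} (t-< : ∀ s → t s < t (suc s)) where

  increasing⇒strictMono : ∀ {s s′} → s < s′ → t s < t s′
  increasing⇒strictMono {s} {suc s′} s<1+s′ with m<1+n⇒m<n∨m≡n s<1+s′
  ... | inj₁ s<s′ = <-trans (increasing⇒strictMono s<s′) (t-< s′)
  ... | inj₂ refl = t-< s

  increasing⇒injective : ∀ {s s′} → t s ≡ t s′ → s ≡ s′
  increasing⇒injective {s} {s′} ts≡ts′ with <-cmp s s′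
  ... | tri< s<s′ _ _ = ⊥-elim (<⇒≢ (increasing⇒strictMono s<s′) ts≡ts′)
  ... | tri≈ _ s≡s′ _ = s≡s′
  ... | tri> _ _ s′<s = ⊥-elim (<⇒≢ (increasing⇒strictMono s′<s) (sym ts≡ts′))

  increasing⇒≥id : ∀ s → s ≤ t s
  increasing⇒≥id zero = z≤n
  increasing⇒≥id (suc s) = ≤-trans (s≤s (increasing⇒≥id s)) (t-< s)

-- The schedule 0; 1,0; 2,1,0; 3,2,1,0; … : the clock holds (block, countdown).
tick : ℕ × ℕ → ℕ × ℕ
tick (b , zero) = suc b , suc b
tick (b , suc i) = b , i

clock : ℕ → ℕ × ℕ
clock zero = zero , zero
clock (suc s) = tick (clock s)

schedule : ℕ → ℕ
schedule = proj₂ ∘ clock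

clock-countdown : ∀ k {s b i} → clock s ≡ (b , k + i) → clock (k + s) ≡ (b , i)
clock-countdown zero e = e
clock-countdown (suc k) {b = b} {i} e =
  cong tick (clock-countdown k (trans e (cong (b ,_) (sym (+-suc k i)))))

clock-reset : ∀ b → ∃ λ s → clock s ≡ (b , b)
clock-reset zero = zero , refl
clock-reset (suc b) with clock-reset b
... | s , e = suc (b + s) , cong tick (clock-countdown b (trans e (cong (b ,_) (sym (+-identityʳ b)))))

schedule-visits : ∀ n M → ∃ λ s → M ≤ s × schedule s ≡ n
schedule-visits n M with clock-reset (M + n)
... | s , e = M + s , m≤m+n M s , cong proj₂ (clock-countdown M e)

module _ (lem : LEM) where

  decide : (P : Set) → Dec P
  decide P = map′ lower lift lem

  by-contradiction : {P : Set} → ¬ ¬ P → P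
  by-contradiction = decidable-stable (decide _)

  Infinite-split : (P : ℕ → Set) {Z : Rel2} → Infinite Z →
                   Infinite (Z ↾ P) ⊎ Infinite (Z ↾ (¬_ ∘ P))
  Infinite-split P {Z} infinite with decide (Finite (Z ↾ P))
  ... | no ¬finite = inj₁ ¬finite
  ... | yes finite = inj₂ (infinite ∘ Finite-∪ cover finite)
    where
    cover : ∀ n m → Z n m → (Z ↾ P) n m ⊎ (Z ↾ (¬_ ∘ P)) n m
    cover n m z with decide (P n)
    ... | yes p = inj₁ (z , p)
    ... | no ¬p = inj₂ (z , ¬p)

  fresh-index : {h : ℕ → ℕ → ℕ} → (∀ {i j} → i < j → Distinct (h j) (h i)) →
                (gs : List (ℕ → ℕ)) (M : ℕ) → ∃ λ n → M ≤ n × All (λ g → Distinct g (h n)) gs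
  fresh-index distinct [] M = M , ≤-refl , []
  fresh-index {h} distinct (g ∷ gs) M with fresh-index distinct gs M
  ... | n , M≤n , gs≠hn with decide (∀ x → g x ≡ h n x)
  ...   | no g≠hn = n , M≤n , g≠hn ∷ gs≠hn
  ...   | yes g≡hn with fresh-index distinct gs (suc n)
  ...     | n′ , n<n′ , gs≠hn′ =
    n′ , ≤-trans M≤n (<⇒≤ n<n′) , g≠hn′ ∷ gs≠hn′
    where
    g≠hn′ : Distinct g (h n′)
    g≠hn′ g≡hn′ = distinct n<n′ λ x → trans (sym (g≡hn′ x)) (g≡hn x)

  module _ {𝒜 : Family} (ad : AlmostDisjoint 𝒜) {f : ℕ → ℕ} where

    TraceFamily-almostDisjoint : ∀ Y Z → TraceFamily 𝒜 f Y → TraceFamily 𝒜 f Z →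
                                 ¬ (Y ≐ Z) → Finite (Y ∩ Z)
    TraceFamily-almostDisjoint Y Z (g , g∈𝒜 , _ , Y⊆ , ⊆Y) (g′ , g′∈𝒜 , _ , Z⊆ , ⊆Z) Y≠Z
      with decide (∀ x → g x ≡ g′ x)
    ... | yes g≡g′ = ⊥-elim (Y≠Z ( (λ n m → ⊆Z n m ∘ map₂ (trans (sym (g≡g′ n))) ∘ Y⊆ n m)
                                 , (λ n m → ⊆Y n m ∘ map₂ (trans (g≡g′ n)) ∘ Z⊆ n m)))
    ... | no g≠g′ = Finite-⊆ (λ n m (y , z) → proj₂ (Y⊆ n m y) , proj₂ (Z⊆ n m z))
                             (ad g g′ g∈𝒜 g′∈𝒜 g≠g′)

    InTrace-intro : EveryInfinitePartMeets 𝒜 (graph f) → InTrace 𝒜 f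
    InTrace-intro meets = member , TraceFamily-almostDisjoint , hit
      where
      member : ∀ Y → TraceFamily 𝒜 f Y → Y ⊆ graph f × Infinite Y
      member Y (_ , _ , infinite , Y⊆ , ⊆Y) = (λ n m → proj₁ ∘ Y⊆ n m) , Infinite-⊇ ⊆Y infinite

      hit : ∀ Z → Z ⊆ graph f → Infinite Z → Σ Rel2 λ Y → TraceFamily 𝒜 f Y × Infinite (Z ∩ Y)
      hit Z Z⊆f infinite with meets Z Z⊆f infinite
      ... | g , g∈𝒜 , meet =
        (graph f ∩ graph g)
        , (g , g∈𝒜 , Infinite-⊇ (λ n m (gn≡m , z) → Z⊆f n m z , gn≡m) meet
             , (λ _ _ y → y) , (λ _ _ y → y))
        , Infinite-⊇ (λ n m (gn≡m , z) → z , Z⊆f n m z , gn≡m) meet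

  module Construction {𝒜 : Family} (ad : AlmostDisjoint 𝒜) (X : Rel2) (avoids : Avoids X 𝒜)
                      (meets : EveryInfinitePartMeets 𝒜 X) where

    mutual
      h : ℕ → ℕ → ℕ
      h n = proj₁ (chosen n)

      earlier : ℕ → List (ℕ → ℕ)
      earlier zero = []
      earlier (suc n) = h n ∷ earlier n

      earlier-∈𝒜 : ∀ n → All 𝒜 (earlier n)
      earlier-∈𝒜 zero = []
      earlier-∈𝒜 (suc n) = proj₁ (proj₂ (chosen n)) ∷ earlier-∈𝒜 n

      chosen : ∀ n → Meets 𝒜 (X ∖ UnionGraphs (earlier n))
      chosen n = meets _ (λ _ _ → proj₁) (avoids (earlier n) (earlier-∈𝒜 n))

    h-∈𝒜 : ∀ n → 𝒜 (h n)
    h-∈𝒜 n = proj₁ (proj₂ (chosen n))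

    h-new : ∀ n → Infinite (graph (h n) ∩ (X ∖ UnionGraphs (earlier n)))
    h-new n = proj₂ (proj₂ (chosen n))

    h-∈-earlier : ∀ {i j} → i < j → ∀ m → UnionGraphs (earlier j) m (h i m)
    h-∈-earlier {j = suc j} i<1+j m with m<1+n⇒m<n∨m≡n i<1+j
    ... | inj₁ i<j = there (h-∈-earlier i<j m)
    ... | inj₂ refl = here refl

    h-distinct : ∀ {i j} → i < j → Distinct (h j) (h i)
    h-distinct {i} {j} i<j hj≡hi = h-new j (zero , λ n m (hjn≡m , _ , ∉earlier) →
      ⊥-elim (∉earlier (subst (UnionGraphs (earlier j) n) (trans (sym (hj≡hi n)) hjn≡m)
                              (h-∈-earlier i<j n))))

    h-meets-X : ∀ n M → ∃ λ m → M ≤ m × X m (h n m)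
    h-meets-X n M = by-contradiction λ none →
      graph-∩-unbounded (h n) (h-new n) M λ m M≤m z → none (m , M≤m , proj₁ z)

    point : ℕ → ℕ
    point zero = proj₁ (h-meets-X (schedule zero) zero)
    point (suc s) = proj₁ (h-meets-X (schedule (suc s)) (suc (point s)))

    point-∈X : ∀ s → X (point s) (h (schedule s) (point s))
    point-∈X zero = proj₂ (proj₂ (h-meets-X (schedule zero) zero))
    point-∈X (suc s) = proj₂ (proj₂ (h-meets-X (schedule (suc s)) (suc (point s))))

    point-< : ∀ s → point s < point (suc s)
    point-< s = proj₁ (proj₂ (h-meets-X (schedule (suc s)) (suc (point s))))

    Marked : ℕ → Set
    Marked m = ∃ λ s → point s ≡ m

    f : ℕ → ℕ
    f m with decide (Marked m)
    ... | yes (s , _) = h (schedule s) m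
    ... | no _ = h zero m

    f-marked : ∀ {s m} → point s ≡ m → f m ≡ h (schedule s) m
    f-marked {s} {m} ps≡m with decide (Marked m)
    ... | yes (s′ , ps′≡m) =
      cong (λ k → h (schedule k) m) (increasing⇒injective point-< {s′} {s} (trans ps′≡m (sym ps≡m)))
    ... | no unmarked = ⊥-elim (unmarked (s , ps≡m))

    f-unmarked : ∀ {m} → ¬ Marked m → f m ≡ h zero m
    f-unmarked {m} unmarked with decide (Marked m)
    ... | yes marked = ⊥-elim (unmarked marked)
    ... | no _ = refl

    marked-⊆X : {Z : Rel2} → Z ⊆ graph f → (Z ↾ Marked) ⊆ X
    marked-⊆X Z⊆f _ m (z , s , refl) =
      subst (X (point s)) (trans (sym (f-marked {s} refl)) (Z⊆f _ m z)) (point-∈X s)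

    f-meets : EveryInfinitePartMeets 𝒜 (graph f)
    f-meets Z Z⊆f infinite with Infinite-split Marked infinite
    ... | inj₁ infinitely-marked with meets (Z ↾ Marked) (marked-⊆X Z⊆f) infinitely-marked
    ...   | g , g∈𝒜 , meet = g , g∈𝒜 , Infinite-⊇ (λ n m (gn≡m , z , _) → gn≡m , z) meet
    f-meets Z Z⊆f infinite | inj₂ infinitely-unmarked =
      h zero , h-∈𝒜 zero , Infinite-⊇ on-h₀ infinitely-unmarked
      where
      on-h₀ : (Z ↾ (¬_ ∘ Marked)) ⊆ (graph (h zero) ∩ Z)
      on-h₀ n m (z , unmarked) = trans (sym (f-unmarked unmarked)) (Z⊆f n m z) , z

    f-avoids : Avoids (graph f) 𝒜
    f-avoids gs gs∈𝒜 (N , bounded) with fresh-index h-distinct gs zero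
    ... | n , _ , gs≠hn with UnionGraphs-meets-Finite ad (h-∈𝒜 n) gs∈𝒜 gs≠hn
    ...   | B , bounded-meet with schedule-visits n (N + B)
    ...     | s , N+B≤s , σs≡n =
      ≤⇒≯ (m+n≤o⇒m≤o N N+B≤m) (proj₁ (bounded m (f m) (refl , ∉gs)))
      where
      m = point s
      N+B≤m : N + B ≤ m
      N+B≤m = ≤-trans N+B≤s (increasing⇒≥id point-< s)
      fm≡hnm : f m ≡ h n m
      fm≡hnm = trans (f-marked {s} refl) (cong (λ k → h k m) σs≡n)
      ∉gs : ¬ UnionGraphs gs m (f m)
      ∉gs u = ≤⇒≯ (m+n≤o⇒n≤o N N+B≤m) (proj₁ (bounded-meet m (f m) (sym fm≡hnm , u)))

  avoiding-trace-member : {𝒜 : Family} → AlmostDisjoint 𝒜 → (X : Rel2) → Avoids X 𝒜 →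
                          EveryInfinitePartMeets 𝒜 X →
                          Σ (ℕ → ℕ) λ f → InTrace 𝒜 f × Avoids (graph f) 𝒜
  avoiding-trace-member ad X avoids meets = f , InTrace-intro ad f-meets , f-avoids
    where open Construction ad X avoids meets

lemma7 : LEM → (𝒜 : Family) → MAD 𝒜 → TrivialTrace 𝒜 →
    (X : Rel2) → Infinite X → Avoids X 𝒜 →
    Σ Rel2 λ Y → Y ⊆ X × Infinite Y × (∀ h → 𝒜 h → Finite (graph h ∩ Y))
lemma7 lem 𝒜 (ad , _) trivial X _ avoids = decidable-stable lem λ no-Y →
  let f , f∈tr , f-avoids = avoiding-trace-member lem ad X avoids (meets no-Y)
  in trivial f f∈tr f-avoids
  where
  meets : ¬ (Σ Rel2 λ Y → Y ⊆ X × Infinite Y × (∀ h → 𝒜 h → Finite (graph h ∩ Y))) →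
          EveryInfinitePartMeets 𝒜 X
  meets no-Y Z Z⊆X infinite = by-contradiction lem λ none →
    no-Y (Z , Z⊆X , infinite , λ g g∈𝒜 → by-contradiction lem λ meet → none (g , g∈𝒜 , meet))
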